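{- For any non-increasing games with activeness $G^g,H^h$, the sum $G^g+H^h$ is non-increasing.
   Context: Let $\mathcal{B}=\{0,1\}$. Define $\mathbb{I}_0=\{\emptyset\}\times\mathcal{B}$ and $\mathbb{I}_n=2^{\mathbb{I}_{n-1}}\times\mathcal{B}$ for $n\ge1$; a game with activeness is an element of $\mathbb{I}=\bigcup_{n\ge0}\mathbb{I}_n$. A pair $(G,g)$ is written $G^g$; elements of $G$ are its options. The sum is defined recursively by $G^g+H^h=(\{G'^{g'}+H^h:G'^{g'}\in G^g\}\cup\{G^g+H'^{h'}:H'^{h'}\in H^h\})^{\max\{g,h\}}$. A game $G^g$ is non-increasing (recursively) if every option $G'^{g'}\in G^g$ is non-increasing and satisfies $g'\le g$. -}

module Defs where

open import Data.Bool using (Bool; false; true; _∨_)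
open import Data.Bool.Properties using ()
open import Data.List using (List; []; _∷_; _++_; map)
open import Data.List.Relation.Unary.All using (All)
open import Data.Product using (_×_)
import Data.Bool as B

-- A game with activeness G^g: a finite collection of options together with an
-- activeness bit g ∈ B = {0,1} (false = 0, true = 1).  Every element of
-- 𝕀 = ⋃ 𝕀_n is a hereditarily finite set of options, represented here as a
-- rose tree with a list of options (order/duplicates are irrelevant for the
-- notions below, which only use membership).
data Game : Set where
  node : List Game → Bool → Game

options : Game → List Game
options (node os _) = os

act : Game → Bool
act (node _ g) = g

-- Sum:  G^g + H^h = ({G' + H^h} ∪ {G^g + H'})^{max g h}
-- (max on {0,1} is boolean disjunction).
mutual
  _⊕_ : Game → Game → Game
  node gs g ⊕ node hs h = node (leftOpts gs (node hs h) ++ rightOpts (node gs g) hs) (g ∨ h)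

  leftOpts : List Game → Game → List Game
  leftOpts [] H = []
  leftOpts (G' ∷ gs) H = (G' ⊕ H) ∷ leftOpts gs H

  rightOpts : Game → List Game → List Game
  rightOpts G [] = []
  rightOpts G (H' ∷ hs) = (G ⊕ H') ∷ rightOpts G hs

data NonIncreasing : Game → Set where
  nonInc : ∀ {os g} →
           All (λ G' → NonIncreasing G' × (act G' B.≤ g)) os →
           NonIncreasing (node os g)

module Submission where

open import Data.Bool using (Bool; false; true; _∨_)
open import Data.Bool.Base using (_≤_; b≤b; f≤t)
open import Data.Bool.Properties using (≤-refl)
open import Data.List using (_∷_)
open import Data.List.Relation.Unary.All using (All; []; _∷_)
open import Data.List.Relation.Unary.All.Properties using (++⁺)
open import Data.Product using (_×_; _,_)

open import Defs

∨-mono-≤ : ∀ {a b c d} → a ≤ b → c ≤ d → a ∨ c ≤ b ∨ d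
∨-mono-≤ {false} {false} _ c≤d = c≤d
∨-mono-≤ {false} {true} {false} _ _ = f≤t
∨-mono-≤ {false} {true} {true} _ _ = b≤b
∨-mono-≤ {true} {true} _ _ = b≤b

act-⊕-≤ : ∀ G H {g h} → act G ≤ g → act H ≤ h → act (G ⊕ H) ≤ g ∨ h
act-⊕-≤ (node _ _) (node _ _) = ∨-mono-≤

OptionBelow : Bool → Game → Set
OptionBelow g G′ = NonIncreasing G′ × act G′ ≤ g

mutual
  ⊕-nonIncreasing : ∀ {G H} → NonIncreasing G → NonIncreasing H → NonIncreasing (G ⊕ H)
  ⊕-nonIncreasing {node gs g} {node hs h} (nonInc gs≤g) (nonInc hs≤h) =
    nonInc (++⁺ (leftOpts-below gs≤g (nonInc hs≤h)) (rightOpts-below (nonInc gs≤g) hs≤h))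

  leftOpts-below : ∀ {gs g H} → All (OptionBelow g) gs → NonIncreasing H →
                   All (OptionBelow (g ∨ act H)) (leftOpts gs H)
  leftOpts-below [] _ = []
  leftOpts-below {G′ ∷ _} {H = H} ((G′-ni , g′≤g) ∷ gs≤g) H-ni =
    (⊕-nonIncreasing G′-ni H-ni , act-⊕-≤ G′ H g′≤g ≤-refl) ∷ leftOpts-below gs≤g H-ni

  rightOpts-below : ∀ {G hs h} → NonIncreasing G → All (OptionBelow h) hs →
                    All (OptionBelow (act G ∨ h)) (rightOpts G hs)
  rightOpts-below _ [] = []
  rightOpts-below {G} {H′ ∷ _} G-ni ((H′-ni , h′≤h) ∷ hs≤h) =
    (⊕-nonIncreasing G-ni H′-ni , act-⊕-≤ G H′ ≤-refl h′≤h) ∷ rightOpts-below G-ni hs≤h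

theorem4p2 : (G H : Game) → NonIncreasing G → NonIncreasing H → NonIncreasing (G ⊕ H)
theorem4p2 _ _ = ⊕-nonIncreasing
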